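{- For all integers $m\ge 0$ and $k\ge 0$, \begin{multline*} r_{2m,k} = \delta_{1,m}\delta_{0,k}+ \sum_{i=0}^{\lfloor \frac m2 \rfloor}(-1)^i\binom{m-i}{i} \binom{m-2i;3}{k-2i} -\sum_{i=0}^{\lfloor \frac{m-1}{2} \rfloor}(-1)^i\binom{m-i-1}{i}\binom{m-2i-1;3}{k-2i}\\ +\sum_{i=0}^{\lfloor \frac{m-2}{2} \rfloor}(-1)^i\binom{m-i-2}{i}\binom{m-2i-2;3}{k-2i} \end{multline*} and \begin{multline*} r_{2m+1,k} = \sum_{i=0}^{\lfloor\frac{m}{2}\rfloor} (-1)^i \binom{m-i}{i}\left(\binom{m-2i;3}{k-2i}+ \binom{m-2i;3}{k-2i-1}\right) \\ -\sum_{i=0}^{\lfloor\frac{m-1}{2} \rfloor} (-1)^i \binom{m-i-1}{i}\left(\binom{m-2i-1;3}{k-2i-1} +\binom{m-2i-1;3}{k-2i-2}\right). \end{multline*}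
   Context: For $n\ge 0$, the $S$-fence $\phi_n$ is the poset on $\{x_1,\dots,x_n\}$ whose order is generated by the cover relations $x_2<x_1$, $x_3<x_2$, $x_2<x_4$, $x_5<x_4$, and, for every $i\ge 3$, $x_{2i-1}<x_{2i}$ and $x_{2i+1}<x_{2i}$, keeping only those relations whose elements both have index $\le n$ ($\phi_0$ is empty). A filter is an up-set. $\mathcal{F}(\phi_n)$ is the set of filters of $\phi_n$ ordered by reverse inclusion; the rank of a filter $Y$ is $n-|Y|$, and $r_{n,k}$ is the number of elements of rank $k$ in $\mathcal{F}(\phi_n)$. For integers $N\ge 0$ and $k$, $\binom{N;3}{k}$ denotes the coefficient of $x^k$ in $(1+x+x^2)^N$ (it equals $0$ for $k<0$), equivalently $\sum_{i=0}^{\lfloor k/2\rfloor}\binom{N}{k-i}\binom{k-i}{i}$ for $k\ge0$. $\delta$ is the Kronecker delta; a sum whose upper limit is smaller than its lower limit is $0$; $\binom{a}{b}=0$ unless $0\le b\le a$. -}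

module Defs where

open import Data.Bool using (Bool; true; false; _∧_; _∨_; not; if_then_else_)
open import Data.Nat as ℕ using (ℕ; zero; suc; _∸_; _≡ᵇ_; _≤ᵇ_; _/_)
open import Data.Nat.Combinatorics using (_C_)
open import Data.Integer as ℤ using (ℤ; +_; -[1+_]; _-_; _^_)
open import Data.List using (List; []; _∷_; length; filterᵇ; map; _++_; upTo)
open import Data.Bool.ListAction using (and)
open import Data.Vec using (Vec; []; _∷_; lookup; toList)
open import Data.Fin using (Fin; fromℕ<)
open import Data.Product using (_×_; _,_)
open import Relation.Nullary.Decidable using (does)
open import Relation.Binary.PropositionalEquality using (_≡_)

-- The S-fence φ_n on {x_1,…,x_n} (1-based indices).
-- cover? a b = true  iff  x_a < x_b is one of the generating cover
-- relations:  x2<x1, x3<x2, x2<x4, x5<x4, and for i ≥ 3: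
-- x_{2i-1} < x_{2i}, x_{2i+1} < x_{2i}.

isEven : ℕ → Bool
isEven zero = true
isEven (suc zero) = false
isEven (suc (suc n)) = isEven n

cover? : ℕ → ℕ → Bool
cover? a b =
  ((a ≡ᵇ 2) ∧ (b ≡ᵇ 1)) ∨ ((a ≡ᵇ 3) ∧ (b ≡ᵇ 2)) ∨
  ((a ≡ᵇ 2) ∧ (b ≡ᵇ 4)) ∨ ((a ≡ᵇ 5) ∧ (b ≡ᵇ 4)) ∨
  ((6 ≤ᵇ b) ∧ isEven b ∧ ((a ≡ᵇ (b ∸ 1)) ∨ (a ≡ᵇ suc b)))

-- A subset Y of {x_1,…,x_n} is a vector of booleans; mem Y j says x_j ∈ Y
-- (j is 1-based; out of range indices are not members).
mem : ∀ {n} → Vec Bool n → ℕ → Bool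
mem [] _ = false
mem (b ∷ _) (suc zero) = b
mem (_ ∷ v) (suc (suc j)) = mem v (suc j)
mem (_ ∷ _) zero = false

indices : ℕ → List ℕ
indices n = map suc (upTo n)

-- Y is a filter (up-set) of φ_n: it is closed upward along every cover
-- relation among x_1,…,x_n (equivalently along the order they generate).
allL : ∀ {A : Set} → (A → Bool) → List A → Bool
allL p xs = and (map p xs)

isFilter : ∀ {n} → Vec Bool n → Bool
isFilter {n} Y =
  allL (λ a → allL (λ b → not (cover? a b ∧ mem Y a ∧ not (mem Y b))) (indices n))
      (indices n)

size : ∀ {n} → Vec Bool n → ℕ
size Y = length (filterᵇ (λ b → b) (toList Y))

subsets : (n : ℕ) → List (Vec Bool n)
subsets zero = [] ∷ []
subsets (suc n) = map (true ∷_) (subsets n) ++ map (false ∷_) (subsets n)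

-- r n k = number of filters Y of φ_n of rank n - |Y| = k
r : ℕ → ℕ → ℕ
r n k = length (filterᵇ (λ Y → ℕ._+_ (size Y) k ≡ᵇ n)
                       (filterᵇ isFilter (subsets n)))

-- Trinomial coefficients: coefficient of x^k in (1+x+x²)^N.

addL : List ℕ → List ℕ → List ℕ
addL [] q = q
addL p [] = p
addL (a ∷ p) (b ∷ q) = ℕ._+_ a b ∷ addL p q

mul3 : List ℕ → List ℕ
mul3 p = addL p (addL (0 ∷ p) (0 ∷ 0 ∷ p))

trinomPoly : ℕ → List ℕ
trinomPoly zero = 1 ∷ []
trinomPoly (suc N) = mul3 (trinomPoly N)

coeff : List ℕ → ℕ → ℕ
coeff [] _ = 0
coeff (a ∷ _) zero = a
coeff (_ ∷ p) (suc k) = coeff p k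

tri : ℕ → ℤ → ℤ
tri N (+ k) = + coeff (trinomPoly N) k
tri N -[1+ _ ] = + 0

sumUpTo : ℕ → (ℕ → ℤ) → ℤ
sumUpTo zero f = f 0
sumUpTo (suc u) f = ℤ._+_ (sumUpTo u f) (f (suc u))

sumFloor : ℕ → ℕ → (ℕ → ℤ) → ℤ
sumFloor m j f = if j ≤ᵇ m then sumUpTo ((m ∸ j) / 2) f else + 0

sgn : ℕ → ℤ
sgn i = -[1+ 0 ] ^ i

binZ : ℕ → ℕ → ℤ
binZ a b = + (a C b)

_⊖_ : ℕ → ℕ → ℤ
k ⊖ t = + k - + t

kron : ℕ → ℕ → ℤ
kron a b = if a ≡ᵇ b then + 1 else + 0

evenFormula : ℕ → ℕ → ℤ
evenFormula m k =
  ℤ._+_ (ℤ._+_ (ℤ._*_ (kron 1 m) (kron 0 k))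
    (sumFloor m 0 (λ i → ℤ._*_ (ℤ._*_ (sgn i) (binZ (m ∸ i) i))
                               (tri (m ∸ (2 ℕ.* i)) (k ⊖ (2 ℕ.* i))))))
  (ℤ._+_ (ℤ.-_ (sumFloor m 1 (λ i → ℤ._*_ (ℤ._*_ (sgn i) (binZ (m ∸ i ∸ 1) i))
                               (tri (m ∸ (2 ℕ.* i) ∸ 1) (k ⊖ (2 ℕ.* i))))))
    (sumFloor m 2 (λ i → ℤ._*_ (ℤ._*_ (sgn i) (binZ (m ∸ i ∸ 2) i))
                               (tri (m ∸ (2 ℕ.* i) ∸ 2) (k ⊖ (2 ℕ.* i))))))

oddFormula : ℕ → ℕ → ℤ
oddFormula m k =
  sumFloor m 0 (λ i → ℤ._*_ (ℤ._*_ (sgn i) (binZ (m ∸ i) i))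
     (ℤ._+_ (tri (m ∸ (2 ℕ.* i)) (k ⊖ (2 ℕ.* i)))
            (tri (m ∸ (2 ℕ.* i)) (k ⊖ suc (2 ℕ.* i)))))
  - sumFloor m 1 (λ i → ℤ._*_ (ℤ._*_ (sgn i) (binZ (m ∸ i ∸ 1) i))
     (ℤ._+_ (tri (m ∸ (2 ℕ.* i) ∸ 1) (k ⊖ suc (2 ℕ.* i)))
            (tri (m ∸ (2 ℕ.* i) ∸ 1) (k ⊖ suc (suc (2 ℕ.* i))))))

-- Every generating cover relation of the S-fence joins
-- neighbours x_{i−1}, x_i except x₂ < x₄, so being a filter is decided by one left-to-right scan
-- that remembers x_{i−1} and x₂. Counting filters by rank turns the scan into a transfer matrix:
-- from x₆ on the fence is 2-periodic, and two steps act on (x_{i−1} present, absent) by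
-- [[1, x], [1, x + x²]]. Its characteristic polynomial gives R_{n+4} = (1 + x + x²) R_{n+2} − x² R_n
-- for the rank generating functions R_n, n ≥ 5. Pascal's rule gives the matching recurrence
-- U_{m+2} = (1 + x + x²) U_{m+1} − x² U_m for U_m = Σ_i (−1)^i C(m−i, i) x^{2i} (1 + x + x²)^{m−2i},
-- and the two formulas are U_m − U_{m−1} + U_{m−2} (+ δ_{1,m}) and (1 + x)(U_m − x U_{m−1}).
-- Both sides thus obey one recurrence in m, and their first terms agree by evaluation.
module Submission where

open import Defs
open import Data.Bool using (Bool; true; false; _∧_; _∨_; not; if_then_else_; T)
open import Data.Bool.Properties using (T-∧; T-∨; ∧-comm; ∧-zeroʳ)
open import Data.Nat as ℕ using (ℕ; zero; suc; _∸_; _≤_; _<_; z≤n; s≤s; z<s; s<s; _≡ᵇ_; _/_)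
open import Data.Nat.Properties
  using (≤-refl; ≤-trans; n≤1+n; m≤n⇒m<n∨m≡n; <-irrefl; +-suc; +-comm; +-identityʳ; m<m+n;
         ≡ᵇ⇒≡; ≡⇒≡ᵇ; +-cancelˡ-≡; _<?_; ≮⇒≥; m+[n∸m]≡n; *-comm; ≤-<-connex; +-∸-assoc;
         m≤n⇒m∸n≡0; m≤n⇒m≤1+n; m∸n+n≡m; m≤n+m; ≰⇒>; <⇒≱)
import Data.Nat.Properties as ℕ
open import Data.Integer as ℤ using (ℤ; +_; -[1+_]; _+_; _-_; -_; pred)
import Data.Integer.Properties as ℤ
open import Data.Integer.Tactic.RingSolver using (solve-∀)
open import Data.List using (List; []; _∷_; length; filterᵇ; map; _++_)
open import Data.List.Properties using (length-++; filter-++)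
open import Data.List.Relation.Unary.All.Properties
  using (all⁺; all⁻; map⁺; map⁻; applyUpTo⁺₁; applyUpTo⁻)
open import Data.Vec using (Vec; []; _∷_; tabulate; lookup)
open import Data.Vec.Properties using (lookup∘tabulate)
open import Data.Fin using (toℕ; fromℕ<)
open import Data.Fin.Properties using (toℕ-fromℕ<)
open import Data.Product using (_×_; _,_; proj₁; proj₂; ∃-syntax)
open import Data.Sum using (_⊎_; inj₁; inj₂)
open import Data.Empty using (⊥-elim)
open import Function using (id; _∘_; _⇔_; mk⇔; Equivalence)
open import Relation.Nullary using (yes; no)
open import Relation.Nullary.Decidable using (T?)
open import Relation.Binary.PropositionalEquality

open Equivalence using (to; from)

_⇒ᵇ_ : Bool → Bool → Bool
a ⇒ᵇ b = not a ∨ b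

T-⇒ᵇ : ∀ {a b} → T (a ⇒ᵇ b) ⇔ (T a → T b)
T-⇒ᵇ {true}  {true}  = mk⇔ (λ _ _ → _) (λ _ → _)
T-⇒ᵇ {true}  {false} = mk⇔ (λ ()) (λ f → f _)
T-⇒ᵇ {false}         = mk⇔ (λ _ ()) (λ _ → _)

not-∧-not : ∀ x y z → not (x ∧ y ∧ not z) ≡ x ⇒ᵇ (y ⇒ᵇ z)
not-∧-not true  true  true  = refl
not-∧-not true  true  false = refl
not-∧-not true  false _     = refl
not-∧-not false _     _     = refl

T-injective : ∀ {x y} → (T x → T y) → (T y → T x) → x ≡ y
T-injective {true}  {true}  _ _ = refl
T-injective {false} {false} _ _ = refl
T-injective {true}  {false} x⇒y _ = ⊥-elim (x⇒y _)
T-injective {false} {true}  _ y⇒x = ⊥-elim (y⇒x _)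

T-∨ʳ : ∀ x {y} → T y → T (x ∨ y)
T-∨ʳ x h = from (T-∨ {x}) (inj₂ h)

isEven-suc : ∀ k → isEven (suc k) ≡ not (isEven k)
isEven-suc zero          = refl
isEven-suc (suc zero)    = refl
isEven-suc (suc (suc k)) = isEven-suc k

-- Cover i a b: x_a ⋖ x_b is a generating relation of the S-fence and i = max a b.
data Cover : ℕ → ℕ → ℕ → Set where
  x₂⋖x₁   : Cover 2 2 1
  x₃⋖x₂   : Cover 3 3 2
  x₂⋖x₄   : Cover 4 2 4
  x₅⋖x₄   : Cover 5 5 4
  ascent  : ∀ {k} → T (isEven k) → Cover (6 ℕ.+ k) (5 ℕ.+ k) (6 ℕ.+ k)
  descent : ∀ {k} → T (isEven k) → Cover (7 ℕ.+ k) (7 ℕ.+ k) (6 ℕ.+ k)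

record CoverIndices (i a b : ℕ) : Set where
  constructor coverIndicesOf
  field
    a≤i : a ≤ i
    b≤i : b ≤ i
    1≤b : 1 ≤ b
    2≤i : 2 ≤ i
    i≡a⊎i≡b : i ≡ a ⊎ i ≡ b

coverIndices : ∀ {i a b} → Cover i a b → CoverIndices i a b
coverIndices x₂⋖x₁       = coverIndicesOf ≤-refl    (n≤1+n 1) z<s ≤-refl     (inj₁ refl)
coverIndices x₃⋖x₂       = coverIndicesOf ≤-refl    (n≤1+n 2) z<s (s<s z<s) (inj₁ refl)
coverIndices x₂⋖x₄       = coverIndicesOf (s<s z<s) ≤-refl    z<s (s<s z<s) (inj₂ refl)
coverIndices x₅⋖x₄       = coverIndicesOf ≤-refl    (n≤1+n 4) z<s (s<s z<s) (inj₁ refl)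
coverIndices (ascent _)  = coverIndicesOf (n≤1+n _) ≤-refl    z<s (s<s z<s) (inj₂ refl)
coverIndices (descent _) = coverIndicesOf ≤-refl    (n≤1+n _) z<s (s<s z<s) (inj₁ refl)

cover?-zigzag : ∀ a b → T ((6 ℕ.≤ᵇ b) ∧ isEven b ∧ ((a ≡ᵇ (b ℕ.∸ 1)) ∨ (a ≡ᵇ suc b))) →
                T (cover? a b)
cover?-zigzag a b = T-∨ʳ ((a ≡ᵇ 2) ∧ (b ≡ᵇ 1)) ∘ T-∨ʳ ((a ≡ᵇ 3) ∧ (b ≡ᵇ 2))
                  ∘ T-∨ʳ ((a ≡ᵇ 2) ∧ (b ≡ᵇ 4)) ∘ T-∨ʳ ((a ≡ᵇ 5) ∧ (b ≡ᵇ 4))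

cover?-complete : ∀ {i a b} → Cover i a b → T (cover? a b)
cover?-complete x₂⋖x₁ = _
cover?-complete x₃⋖x₂ = _
cover?-complete x₂⋖x₄ = _
cover?-complete x₅⋖x₄ = _
cover?-complete (ascent {k} e) =
  cover?-zigzag (5 ℕ.+ k) (6 ℕ.+ k)
    (from (T-∧ {isEven k}) (e , from (T-∨ {k ≡ᵇ k}) (inj₁ (≡⇒≡ᵇ k k refl))))
cover?-complete (descent {k} e) =
  cover?-zigzag (7 ℕ.+ k) (6 ℕ.+ k)
    (from (T-∧ {isEven k}) (e , from (T-∨ {2 ℕ.+ k ≡ᵇ k}) (inj₂ (≡⇒≡ᵇ k k refl))))

cover?-sound : ∀ a b → T (cover? a b) → ∃[ i ] Cover i a b
cover?-sound a b h with to (T-∨ {(a ≡ᵇ 2) ∧ (b ≡ᵇ 1)}) h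
... | inj₁ h₁ with to (T-∧ {a ≡ᵇ 2}) h₁
...   | ha , hb rewrite ≡ᵇ⇒≡ a 2 ha | ≡ᵇ⇒≡ b 1 hb = 2 , x₂⋖x₁
cover?-sound a b _ | inj₂ h with to (T-∨ {(a ≡ᵇ 3) ∧ (b ≡ᵇ 2)}) h
... | inj₁ h₁ with to (T-∧ {a ≡ᵇ 3}) h₁
...   | ha , hb rewrite ≡ᵇ⇒≡ a 3 ha | ≡ᵇ⇒≡ b 2 hb = 3 , x₃⋖x₂
cover?-sound a b _ | inj₂ _ | inj₂ h with to (T-∨ {(a ≡ᵇ 2) ∧ (b ≡ᵇ 4)}) h
... | inj₁ h₁ with to (T-∧ {a ≡ᵇ 2}) h₁
...   | ha , hb rewrite ≡ᵇ⇒≡ a 2 ha | ≡ᵇ⇒≡ b 4 hb = 4 , x₂⋖x₄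
cover?-sound a b _ | inj₂ _ | inj₂ _ | inj₂ h with to (T-∨ {(a ≡ᵇ 5) ∧ (b ≡ᵇ 4)}) h
... | inj₁ h₁ with to (T-∧ {a ≡ᵇ 5}) h₁
...   | ha , hb rewrite ≡ᵇ⇒≡ a 5 ha | ≡ᵇ⇒≡ b 4 hb = 5 , x₅⋖x₄
cover?-sound a (suc (suc (suc (suc (suc (suc k)))))) _ | inj₂ _ | inj₂ _ | inj₂ _ | inj₂ h
  with to (T-∧ {isEven k}) h
... | e , h₁ with to (T-∨ {a ≡ᵇ 5 ℕ.+ k}) h₁
...   | inj₁ ha rewrite ≡ᵇ⇒≡ a (5 ℕ.+ k) ha = 6 ℕ.+ k , ascent e
...   | inj₂ ha rewrite ≡ᵇ⇒≡ a (7 ℕ.+ k) ha = 7 ℕ.+ k , descent e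

-- stepOK i p s c: the constraint imposed by the unique cover relation whose larger index is i,
-- where p, s, c tell whether x_{i-1}, x_2, x_i belong to the subset.
stepOK : ℕ → Bool → Bool → Bool → Bool
stepOK 2 p s c = c ⇒ᵇ p
stepOK 3 p s c = c ⇒ᵇ p
stepOK 4 p s c = s ⇒ᵇ c
stepOK 5 p s c = c ⇒ᵇ p
stepOK i@(suc (suc (suc (suc (suc (suc _)))))) p s c = if isEven i then p ⇒ᵇ c else c ⇒ᵇ p
stepOK _ _ _ _ = true

scanFrom : ∀ {L} → ℕ → Bool → Bool → Vec Bool L → Bool
scanFrom i p s []      = true
scanFrom i p s (c ∷ v) = stepOK i p s c ∧ scanFrom (suc i) c s v

scan : ∀ {n} → Vec Bool n → Bool
scan (y₁ ∷ y₂ ∷ v) = scanFrom 2 y₁ y₂ (y₂ ∷ v)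
scan _             = true

UpClosed : (ℕ → Bool) → ℕ → ℕ → Set
UpClosed m lo n = ∀ {i a b} → Cover i a b → lo ≤ i → i ≤ n → T (m a) → T (m b)

stepOK-sound : ∀ (m : ℕ → Bool) i → T (stepOK (suc i) (m i) (m 2) (m (suc i))) →
               ∀ {a b} → Cover (suc i) a b → T (m a) → T (m b)
stepOK-sound m _ h x₂⋖x₁ = to T-⇒ᵇ h
stepOK-sound m _ h x₃⋖x₂ = to T-⇒ᵇ h
stepOK-sound m _ h x₂⋖x₄ = to T-⇒ᵇ h
stepOK-sound m _ h x₅⋖x₄ = to T-⇒ᵇ h
stepOK-sound m _ h (ascent {k} e) with isEven k | e
... | true | _ = to T-⇒ᵇ h
stepOK-sound m _ h (descent {k} e) rewrite isEven-suc k with isEven k | e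
... | true | _ = to T-⇒ᵇ h

stepOK-complete : ∀ (m : ℕ → Bool) i → 1 ≤ i →
                  (∀ {a b} → Cover (suc i) a b → T (m a) → T (m b)) →
                  T (stepOK (suc i) (m i) (m 2) (m (suc i)))
stepOK-complete m 1 _ f = from T-⇒ᵇ (f x₂⋖x₁)
stepOK-complete m 2 _ f = from T-⇒ᵇ (f x₃⋖x₂)
stepOK-complete m 3 _ f = from T-⇒ᵇ (f x₂⋖x₄)
stepOK-complete m 4 _ f = from T-⇒ᵇ (f x₅⋖x₄)
stepOK-complete m 5 _ f = from T-⇒ᵇ (f (ascent _))
stepOK-complete m (suc (suc (suc (suc (suc (suc k)))))) _ f rewrite isEven-suc k with isEven k in e
... | true  = from T-⇒ᵇ (f (descent (subst T (sym e) _)))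
... | false = from T-⇒ᵇ (f (ascent (subst T (sym (trans (isEven-suc k) (cong not e))) _)))

Agrees : (ℕ → Bool) → ℕ → ∀ {L} → Vec Bool L → Set
Agrees m i w = ∀ j → mem w (suc j) ≡ m (j ℕ.+ i)

scanFrom⇔UpClosed : ∀ (m : ℕ → Bool) n {L} i (w : Vec Bool L) →
                    1 ≤ i → i ℕ.+ L ≡ n → Agrees m (suc i) w →
                    T (scanFrom (suc i) (m i) (m 2) w) ⇔ UpClosed m (suc i) n
-- Giving B to mk⇔ keeps Agda from instantiating the implicit binders of UpClosed too early.
scanFrom⇔UpClosed m n i [] _ i+0≡n _ = mk⇔ {B = UpClosed m (suc i) n} (λ _ → vacuous) _
  where
  vacuous : UpClosed m (suc i) n
  vacuous _ lo hi =
    ⊥-elim (<-irrefl refl (≤-trans lo (subst (_ ≤_) (trans (sym i+0≡n) (+-identityʳ i)) hi)))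
scanFrom⇔UpClosed m n {suc L} i (c ∷ w) 1≤i i+L≡n agrees rewrite agrees 0 = mk⇔ up down
  where
  rest : T (scanFrom (suc (suc i)) (m (suc i)) (m 2) w) ⇔ UpClosed m (suc (suc i)) n
  rest = scanFrom⇔UpClosed m n (suc i) w (s≤s z≤n) (trans (sym (+-suc i L)) i+L≡n)
           (λ j → trans (agrees (suc j)) (cong m (sym (+-suc j (suc i)))))
  up : T (stepOK (suc i) (m i) (m 2) (m (suc i)) ∧ scanFrom (suc (suc i)) (m (suc i)) (m 2) w) →
       UpClosed m (suc i) n
  up h cv lo hi with to T-∧ h | m≤n⇒m<n∨m≡n lo
  ... | step , _ | inj₂ refl = stepOK-sound m i step cv
  ... | _ , tail | inj₁ lt   = to rest tail cv lt hi
  down : UpClosed m (suc i) n →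
         T (stepOK (suc i) (m i) (m 2) (m (suc i)) ∧ scanFrom (suc (suc i)) (m (suc i)) (m 2) w)
  down g = from T-∧ ( stepOK-complete m i 1≤i (λ cv → g cv ≤-refl (subst (suc i ≤_) i+L≡n (m<m+n i z<s)))
                    , from rest (λ cv lo → g cv (≤-trans (n≤1+n _) lo)))

scan⇔UpClosed : ∀ {n} (Y : Vec Bool n) → T (scan Y) ⇔ UpClosed (mem Y) 2 n
scan⇔UpClosed []        = mk⇔ {B = UpClosed (mem []) 2 0} (λ _ → vacuous) _
  where
  vacuous : UpClosed (mem []) 2 0
  vacuous _ lo hi with ≤-trans lo hi
  ... | ()
scan⇔UpClosed (y ∷ [])  = mk⇔ {B = UpClosed (mem (y ∷ [])) 2 1} (λ _ → vacuous) _
  where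
  vacuous : UpClosed (mem (y ∷ [])) 2 1
  vacuous _ lo hi with ≤-trans lo hi
  ... | s≤s ()
scan⇔UpClosed {suc (suc L)} Y@(_ ∷ y₂ ∷ v) =
  scanFrom⇔UpClosed (mem Y) (2 ℕ.+ L) 1 (y₂ ∷ v) ≤-refl refl (λ j → cong (mem Y) (+-comm 2 j))

T-allIndices : ∀ n (p : ℕ → Bool) → T (allL p (indices n)) ⇔ (∀ {a} → 1 ≤ a → a ≤ n → T (p a))
T-allIndices n p = mk⇔ pointwise listwise
  where
  pointwise : T (allL p (indices n)) → ∀ {a} → 1 ≤ a → a ≤ n → T (p a)
  pointwise h (s≤s z≤n) a≤n = applyUpTo⁻ id n (map⁻ (all⁺ p (indices n) h)) a≤n
  listwise : (∀ {a} → 1 ≤ a → a ≤ n → T (p a)) → T (allL p (indices n))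
  listwise h = all⁻ p (map⁺ (applyUpTo⁺₁ id n (h (s≤s z≤n))))

mem-positive : ∀ {n} (Y : Vec Bool n) a → T (mem Y a) → 1 ≤ a
mem-positive Y (suc a) _ = s≤s z≤n
mem-positive (_ ∷ _) zero ()

isFilter⇔UpClosed : ∀ {n} (Y : Vec Bool n) → T (isFilter Y) ⇔ UpClosed (mem Y) 2 n
isFilter⇔UpClosed {n} Y = mk⇔ up down
  where
  respects : ℕ → ℕ → Bool
  respects a b = not (cover? a b ∧ mem Y a ∧ not (mem Y b))
  Respected : Set
  Respected = ∀ {a} → 1 ≤ a → a ≤ n → ∀ {b} → 1 ≤ b → b ≤ n → T (respects a b)
  pairs : T (isFilter Y) ⇔ Respected
  pairs = mk⇔ {B = Respected}
    (λ h {a} 1≤a a≤n → to (T-allIndices n (respects a)) (to (T-allIndices n _) h 1≤a a≤n))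
    (λ h → from (T-allIndices n _) (λ {a} 1≤a a≤n → from (T-allIndices n (respects a)) (h 1≤a a≤n)))
  T-respects : ∀ {a b} → T (respects a b) ⇔ (T (cover? a b) → T (mem Y a) → T (mem Y b))
  T-respects {a} {b} rewrite not-∧-not (cover? a b) (mem Y a) (mem Y b) =
    mk⇔ (λ h c → to T-⇒ᵇ (to T-⇒ᵇ h c)) (λ f → from T-⇒ᵇ (λ c → from T-⇒ᵇ (f c)))
  up : T (isFilter Y) → UpClosed (mem Y) 2 n
  up h {a = a} cv _ i≤n ma =
    to T-respects (to pairs h (mem-positive Y a ma) (≤-trans a≤i i≤n) 1≤b (≤-trans b≤i i≤n))
                  (cover?-complete cv) ma
    where open CoverIndices (coverIndices cv)
  down : UpClosed (mem Y) 2 n → T (isFilter Y)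
  down g = from pairs (λ {a} _ a≤n {b} _ b≤n →
             from T-respects (λ c → let _ , cv = cover?-sound a b c in respected cv a≤n b≤n))
    where
    respected : ∀ {i a b} → Cover i a b → a ≤ n → b ≤ n → T (mem Y a) → T (mem Y b)
    respected cv a≤n b≤n with CoverIndices.i≡a⊎i≡b (coverIndices cv)
    ... | inj₁ refl = g cv (CoverIndices.2≤i (coverIndices cv)) a≤n
    ... | inj₂ refl = g cv (CoverIndices.2≤i (coverIndices cv)) b≤n

isFilter≡scan : ∀ {n} (Y : Vec Bool n) → isFilter Y ≡ scan Y
isFilter≡scan Y = T-injective (from (scan⇔UpClosed Y) ∘ to (isFilter⇔UpClosed Y))
                              (from (isFilter⇔UpClosed Y) ∘ to (scan⇔UpClosed Y))

length-filterᵇ-≗ : ∀ {A : Set} {p q : A → Bool} → (∀ x → p x ≡ q x) → ∀ xs →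
                   length (filterᵇ p xs) ≡ length (filterᵇ q xs)
length-filterᵇ-≗ p≗q [] = refl
length-filterᵇ-≗ {p = p} {q} p≗q (x ∷ xs) with p x | q x | p≗q x
... | true  | true  | refl = cong suc (length-filterᵇ-≗ p≗q xs)
... | false | false | refl = length-filterᵇ-≗ p≗q xs

length-filterᵇ-filterᵇ : ∀ {A : Set} (p q : A → Bool) xs →
                         length (filterᵇ q (filterᵇ p xs)) ≡ length (filterᵇ (λ x → p x ∧ q x) xs)
length-filterᵇ-filterᵇ p q [] = refl
length-filterᵇ-filterᵇ p q (x ∷ xs) with p x
... | false = length-filterᵇ-filterᵇ p q xs
... | true with q x
...   | true  = cong suc (length-filterᵇ-filterᵇ p q xs)
...   | false = length-filterᵇ-filterᵇ p q xs

length-filterᵇ-++ : ∀ {A : Set} (p : A → Bool) xs ys →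
                    length (filterᵇ p (xs ++ ys)) ≡ length (filterᵇ p xs) ℕ.+ length (filterᵇ p ys)
length-filterᵇ-++ p xs ys = trans (cong length (filter-++ (T? ∘ p) xs ys)) (length-++ (filterᵇ p xs))

length-filterᵇ-false : ∀ {A : Set} (xs : List A) → length (filterᵇ (λ _ → false) xs) ≡ 0
length-filterᵇ-false []       = refl
length-filterᵇ-false (_ ∷ xs) = length-filterᵇ-false xs

length-filterᵇ-map : ∀ {A B : Set} (p : B → Bool) (f : A → B) xs →
                     length (filterᵇ p (map f xs)) ≡ length (filterᵇ (p ∘ f) xs)
length-filterᵇ-map p f [] = refl
length-filterᵇ-map p f (x ∷ xs) with p (f x)
... | true  = cong suc (length-filterᵇ-map p f xs)
... | false = length-filterᵇ-map p f xs

rank : ∀ {n} → Vec Bool n → ℕ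
rank []          = 0
rank (true ∷ Y)  = rank Y
rank (false ∷ Y) = suc (rank Y)

size+rank : ∀ {n} (Y : Vec Bool n) → size Y ℕ.+ rank Y ≡ n
size+rank []          = refl
size+rank (true ∷ Y)  = cong suc (size+rank Y)
size+rank (false ∷ Y) = trans (+-suc (size Y) (rank Y)) (cong suc (size+rank Y))

count : (n : ℕ) → (Vec Bool n → Bool) → ℕ
count n p = length (filterᵇ p (subsets n))

count-suc : ∀ n p → count (suc n) p ≡ count n (p ∘ (true ∷_)) ℕ.+ count n (p ∘ (false ∷_))
count-suc n p = trans (length-filterᵇ-++ p (map (true ∷_) (subsets n)) (map (false ∷_) (subsets n)))
  (cong₂ ℕ._+_ (length-filterᵇ-map p (true ∷_) (subsets n)) (length-filterᵇ-map p (false ∷_) (subsets n)))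

Series : Set
Series = ℤ → ℤ

-- Coefficients of Σ_{Y with p Y} x^{rank Y}, indexed by ℤ so that x · f is f ∘ pred; 0 below x⁰.
rankSeries : (n : ℕ) → (Vec Bool n → Bool) → Series
rankSeries n p (+ k)    = + count n (λ Y → (rank Y ≡ᵇ k) ∧ p Y)
rankSeries n p -[1+ _ ] = + 0

rankSeries-≗ : ∀ n {p q : Vec Bool n → Bool} → p ≗ q → rankSeries n p ≗ rankSeries n q
rankSeries-≗ n p≗q (+ k)    =
  cong +_ (length-filterᵇ-≗ (λ Y → cong ((rank Y ≡ᵇ k) ∧_) (p≗q Y)) (subsets n))
rankSeries-≗ n p≗q -[1+ _ ] = refl

rankSeries-suc : ∀ n p w →
  rankSeries (suc n) p w ≡ rankSeries n (p ∘ (true ∷_)) w + rankSeries n (p ∘ (false ∷_)) (pred w)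
rankSeries-suc n p (+ zero)  = cong +_ (trans (count-suc n _)
  (cong (count n (λ Y → (rank Y ≡ᵇ 0) ∧ p (true ∷ Y)) ℕ.+_) (length-filterᵇ-false (subsets n))))
rankSeries-suc n p (+ suc k) = cong +_ (count-suc n _)
rankSeries-suc n p -[1+ _ ]  = refl

when : Bool → ℤ → ℤ
when true  x = x
when false _ = + 0

rankSeries-∧ : ∀ n b q w → rankSeries n (λ Y → b ∧ q Y) w ≡ when b (rankSeries n q w)
rankSeries-∧ n true  q w        = refl
rankSeries-∧ n false q (+ k)    =
  cong +_ (trans (length-filterᵇ-≗ (λ Y → ∧-zeroʳ (rank Y ≡ᵇ k)) (subsets n))
                 (length-filterᵇ-false (subsets n)))
rankSeries-∧ n false q -[1+ _ ] = refl

fenceSeries : ℕ → Series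
fenceSeries n = rankSeries n scan

r≡fenceSeries : ∀ n k → + r n k ≡ fenceSeries n (+ k)
r≡fenceSeries n k = cong +_ (trans (length-filterᵇ-filterᵇ isFilter _ (subsets n))
  (length-filterᵇ-≗ (λ Y → trans (cong₂ _∧_ (isFilter≡scan Y) (rank-weight Y)) (∧-comm (scan Y) _))
                    (subsets n)))
  where
  rank-weight : ∀ Y → (size Y ℕ.+ k ≡ᵇ n) ≡ (rank Y ≡ᵇ k)
  rank-weight Y = T-injective
    (λ h → ≡⇒≡ᵇ (rank Y) k
             (+-cancelˡ-≡ (size Y) (rank Y) k (trans (size+rank Y) (sym (≡ᵇ⇒≡ _ n h)))))
    (λ h → ≡⇒≡ᵇ _ n (trans (cong (size Y ℕ.+_) (sym (≡ᵇ⇒≡ _ k h))) (size+rank Y)))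

record Recurrence (f g h : Series) : Set where
  constructor recurrence
  field
    at : ∀ w → h w ≡ g w + g (pred w) + g (pred (pred w)) - f (pred (pred w))
open Recurrence

Recurrence₁ Recurrence₂ : (ℕ → Series) → ℕ → Set
Recurrence₁ F n = Recurrence (F n) (F (1 ℕ.+ n)) (F (2 ℕ.+ n))
Recurrence₂ F n = Recurrence (F n) (F (2 ℕ.+ n)) (F (4 ℕ.+ n))

Recurrence-≗ : ∀ {f g h f′ g′ h′} → f ≗ f′ → g ≗ g′ → h ≗ h′ →
               Recurrence f g h → Recurrence f′ g′ h′
Recurrence-≗ {f} {g} {h} f≗f′ g≗g′ h≗h′ rec = recurrence λ w →
  trans (sym (h≗h′ w))
        (trans (at rec w) (cong₂ _-_ (cong₂ _+_ (cong₂ _+_ (g≗g′ _) (g≗g′ _)) (g≗g′ _)) (f≗f′ _)))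

Recurrence-+ : ∀ {f g h f′ g′ h′} → Recurrence f g h → Recurrence f′ g′ h′ →
               Recurrence (λ w → f w + f′ w) (λ w → g w + g′ w) (λ w → h w + h′ w)
Recurrence-+ {f} {g} {f′ = f′} {g′} rec rec′ = recurrence λ w →
  trans (cong₂ _+_ (at rec w) (at rec′ w))
        (interchange (g w) (g (pred w)) (g (pred (pred w))) (f (pred (pred w)))
                     (g′ w) (g′ (pred w)) (g′ (pred (pred w))) (f′ (pred (pred w))))
  where
  interchange : ∀ a b c d a′ b′ c′ d′ →
    a + b + c - d + (a′ + b′ + c′ - d′) ≡ (a + a′) + (b + b′) + (c + c′) - (d + d′)
  interchange = solve-∀

Recurrence-neg : ∀ {f g h} → Recurrence f g h → Recurrence (-_ ∘ f) (-_ ∘ g) (-_ ∘ h)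
Recurrence-neg {f} {g} rec = recurrence λ w →
  trans (cong -_ (at rec w)) (negate (g w) (g (pred w)) (g (pred (pred w))) (f (pred (pred w))))
  where
  negate : ∀ a b c d → - (a + b + c - d) ≡ - a + - b + - c - - d
  negate = solve-∀

Recurrence-pred : ∀ {f g h} → Recurrence f g h → Recurrence (f ∘ pred) (g ∘ pred) (h ∘ pred)
Recurrence-pred rec = recurrence (at rec ∘ pred)

Recurrence-when : ∀ b {f g h} → Recurrence f g h → Recurrence (when b ∘ f) (when b ∘ g) (when b ∘ h)
Recurrence-when true  rec = rec
Recurrence-when false rec = recurrence λ _ → refl

-- The two-step transfer matrix [[1, x], [1, x + x²]] has trace 1 + x + x² and determinant x²,
-- so by Cayley–Hamilton both coordinate sequences obey the recurrence.
cayley-hamilton : (a b : ℕ → Series) →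
  (∀ L w → a (2 ℕ.+ L) w ≡ a L w + b L (pred w)) →
  (∀ L w → b (2 ℕ.+ L) w ≡ a L w + b L (pred w) + b L (pred (pred w))) →
  ∀ L → Recurrence₂ a L × Recurrence₂ b L
cayley-hamilton a b a-step b-step L = a-rec , b-rec
  where
  open ≡-Reasoning
  regroupᵃ : ∀ p q r s t → p + (q + r + s) ≡ p + (q + r) + (t + s) - t
  regroupᵃ = solve-∀
  regroupᵇ : ∀ p q r s t → p + q + r + s ≡ p + q + t + r + s - t
  regroupᵇ = solve-∀
  a-rec : Recurrence₂ a L
  a-rec = recurrence λ w → let a₂ = a (2 ℕ.+ L); w₁ = pred w; w₂ = pred w₁; w₃ = pred w₂ in begin
    a (4 ℕ.+ L) w
      ≡⟨ a-step (2 ℕ.+ L) w ⟩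
    a₂ w + b (2 ℕ.+ L) w₁
      ≡⟨ cong (λ x → a₂ w + x) (b-step L w₁) ⟩
    a₂ w + (a L w₁ + b L w₂ + b L w₃)
      ≡⟨ regroupᵃ (a₂ w) (a L w₁) (b L w₂) (b L w₃) (a L w₂) ⟩
    a₂ w + (a L w₁ + b L w₂) + (a L w₂ + b L w₃) - a L w₂
      ≡⟨ cong₂ (λ x y → a₂ w + x + y - a L w₂) (sym (a-step L w₁)) (sym (a-step L w₂)) ⟩
    a₂ w + a₂ w₁ + a₂ w₂ - a L w₂ ∎
  b-rec : Recurrence₂ b L
  b-rec = recurrence λ w → let b₂ = b (2 ℕ.+ L); w₁ = pred w; w₂ = pred w₁ in begin
    b (4 ℕ.+ L) w
      ≡⟨ b-step (2 ℕ.+ L) w ⟩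
    a (2 ℕ.+ L) w + b₂ w₁ + b₂ w₂
      ≡⟨ cong (λ x → x + b₂ w₁ + b₂ w₂) (a-step L w) ⟩
    a L w + b L w₁ + b₂ w₁ + b₂ w₂
      ≡⟨ regroupᵇ (a L w) (b L w₁) (b₂ w₁) (b₂ w₂) (b L w₂) ⟩
    a L w + b L w₁ + b L w₂ + b₂ w₁ + b₂ w₂ - b L w₂
      ≡⟨ cong (λ x → x + b₂ w₁ + b₂ w₂ - b L w₂) (sym (b-step L w)) ⟩
    b₂ w + b₂ w₁ + b₂ w₂ - b L w₂ ∎

scanSeries : ℕ → Bool → Bool → ℕ → Series
scanSeries i p s L = rankSeries L (scanFrom i p s)

scanSeries-suc : ∀ i p s L w → scanSeries i p s (suc L) w ≡
  when (stepOK i p s true) (scanSeries (suc i) true s L w)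
    + when (stepOK i p s false) (scanSeries (suc i) false s L (pred w))
scanSeries-suc i p s L w =
  trans (rankSeries-suc L _ w)
        (cong₂ _+_ (rankSeries-∧ L (stepOK i p s true) (scanFrom (suc i) true s) w)
                   (rankSeries-∧ L (stepOK i p s false) (scanFrom (suc i) false s) (pred w)))

scanFrom-periodic : ∀ k {L} p s (v : Vec Bool L) → scanFrom (8 ℕ.+ k) p s v ≡ scanFrom (6 ℕ.+ k) p s v
scanFrom-periodic k p s []      = refl
scanFrom-periodic k p s (c ∷ v) = cong (stepOK (6 ℕ.+ k) p s c ∧_) (scanFrom-periodic (suc k) c s v)

scanSeries-periodic : ∀ p s L → scanSeries 8 p s L ≗ scanSeries 6 p s L
scanSeries-periodic p s L = rankSeries-≗ L (scanFrom-periodic 0 p s)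

scanSeries-6-true : ∀ s L w →
  scanSeries 6 true s (2 ℕ.+ L) w ≡ scanSeries 6 true s L w + scanSeries 6 false s L (pred w)
scanSeries-6-true s L w = begin
  scanSeries 6 true s (2 ℕ.+ L) w                           ≡⟨ scanSeries-suc 6 true s (suc L) w ⟩
  scanSeries 7 true s (suc L) w + + 0                       ≡⟨ ℤ.+-identityʳ _ ⟩
  scanSeries 7 true s (suc L) w                             ≡⟨ scanSeries-suc 7 true s L w ⟩
  scanSeries 8 true s L w + scanSeries 8 false s L (pred w)
    ≡⟨ cong₂ _+_ (scanSeries-periodic true s L w) (scanSeries-periodic false s L (pred w)) ⟩
  scanSeries 6 true s L w + scanSeries 6 false s L (pred w) ∎
  where open ≡-Reasoning

scanSeries-6-false : ∀ s L w → scanSeries 6 false s (2 ℕ.+ L) w ≡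
  scanSeries 6 true s L w + scanSeries 6 false s L (pred w) + scanSeries 6 false s L (pred (pred w))
scanSeries-6-false s L w = begin
  scanSeries 6 false s (2 ℕ.+ L) w
    ≡⟨ scanSeries-suc 6 false s (suc L) w ⟩
  scanSeries 7 true s (suc L) w + scanSeries 7 false s (suc L) (pred w)
    ≡⟨ cong₂ _+_ (scanSeries-suc 7 true s L w) (scanSeries-suc 7 false s L (pred w)) ⟩
  S₈ true w + S₈ false (pred w) + (+ 0 + S₈ false (pred (pred w)))
    ≡⟨ cong (λ x → S₈ true w + S₈ false (pred w) + x) (ℤ.+-identityˡ _) ⟩
  S₈ true w + S₈ false (pred w) + S₈ false (pred (pred w))
    ≡⟨ cong₂ _+_ (cong₂ _+_ (scanSeries-periodic true s L w) (scanSeries-periodic false s L (pred w)))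
                 (scanSeries-periodic false s L (pred (pred w))) ⟩
  scanSeries 6 true s L w + scanSeries 6 false s L (pred w) + scanSeries 6 false s L (pred (pred w)) ∎
  where
  open ≡-Reasoning
  S₈ : Bool → Series
  S₈ p = scanSeries 8 p s L

scanSeries-6-recurrence : ∀ p s L → Recurrence₂ (scanSeries 6 p s) L
scanSeries-6-recurrence true  s = proj₁ ∘ cayley-hamilton (scanSeries 6 true s) (scanSeries 6 false s)
                                                       (scanSeries-6-true s) (scanSeries-6-false s)
scanSeries-6-recurrence false s = proj₂ ∘ cayley-hamilton (scanSeries 6 true s) (scanSeries 6 false s)
                                                       (scanSeries-6-true s) (scanSeries-6-false s)

scanSeries-recurrence-pred : ∀ i p s L →
  (∀ p′ → Recurrence₂ (scanSeries (suc i) p′ s) L) → Recurrence₂ (scanSeries i p s) (suc L)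
scanSeries-recurrence-pred i p s L rec =
  Recurrence-≗ (sym ∘ scanSeries-suc i p s L) (sym ∘ scanSeries-suc i p s (2 ℕ.+ L))
               (sym ∘ scanSeries-suc i p s (4 ℕ.+ L))
    (Recurrence-+ (Recurrence-when (stepOK i p s true) (rec true))
                  (Recurrence-pred (Recurrence-when (stepOK i p s false) (rec false))))

-- Of the four choices for x₁ and x₂ only x₂ ∈ Y ∌ x₁ is excluded; the scan then resumes at x₃.
headSeries : ℕ → Series
headSeries M w = scanSeries 3 true true M w + scanSeries 3 false false M (pred w)
                   + scanSeries 3 false false M (pred (pred w))

fenceSeries-head : ∀ L → fenceSeries (2 ℕ.+ L) ≗ headSeries L
fenceSeries-head L w = begin
  fenceSeries (2 ℕ.+ L) w
    ≡⟨ rankSeries-suc (suc L) scan w ⟩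
  rankSeries (suc L) (scan ∘ (true ∷_)) w + rankSeries (suc L) (scan ∘ (false ∷_)) (pred w)
    ≡⟨ cong₂ _+_ (rankSeries-suc L _ w) (rankSeries-suc L _ (pred w)) ⟩
  with-x₂ w + without-x₂ (pred w) + (rankSeries L (λ _ → false) (pred w) + without-x₂ (pred (pred w)))
    ≡⟨ cong (λ x → with-x₂ w + without-x₂ (pred w) + (x + without-x₂ (pred (pred w))))
            (rankSeries-∧ L false (λ _ → false) (pred w)) ⟩
  with-x₂ w + without-x₂ (pred w) + (+ 0 + without-x₂ (pred (pred w)))
    ≡⟨ cong (λ x → with-x₂ w + without-x₂ (pred w) + x) (ℤ.+-identityˡ _) ⟩
  headSeries L w ∎
  where
  open ≡-Reasoning
  with-x₂ without-x₂ : Series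
  with-x₂    = scanSeries 3 true true L
  without-x₂ = scanSeries 3 false false L

fenceSeries-recurrence : ∀ L → Recurrence₂ fenceSeries (5 ℕ.+ L)
fenceSeries-recurrence L =
  Recurrence-≗ (sym ∘ fenceSeries-head (3 ℕ.+ L)) (sym ∘ fenceSeries-head (5 ℕ.+ L))
               (sym ∘ fenceSeries-head (7 ℕ.+ L))
    (Recurrence-+ (Recurrence-+ (head true true) (Recurrence-pred (head false false)))
                  (Recurrence-pred (Recurrence-pred (head false false))))
  where
  head : ∀ p s → Recurrence₂ (scanSeries 3 p s) (3 ℕ.+ L)
  head p s = scanSeries-recurrence-pred 3 p s (2 ℕ.+ L) λ p₄ →
             scanSeries-recurrence-pred 4 p₄ s (suc L) λ p₅ →
             scanSeries-recurrence-pred 5 p₅ s L λ p₆ →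
             scanSeries-6-recurrence p₆ s L

-- A module of its own keeps ℤ's _*_ out of the scope of theorem2, whose statement uses ℕ's.
module Chebyshev where

  open import Data.Integer using (_*_)
  open import Data.Nat.Combinatorics using (_C_; k>n⇒nCk≡0; nCk+nC[k+1]≡[n+1]C[k+1])
  open import Data.Nat.DivMod using (/-monoˡ-≤; m*n/n≡m; m/n≤m)

  sumUpTo-cong : ∀ N {f g : ℕ → ℤ} → f ≗ g → sumUpTo N f ≡ sumUpTo N g
  sumUpTo-cong zero    f≗g = f≗g 0
  sumUpTo-cong (suc N) f≗g = cong₂ _+_ (sumUpTo-cong N f≗g) (f≗g (suc N))

  sumUpTo-+ : ∀ N (f g : ℕ → ℤ) → sumUpTo N (λ i → f i + g i) ≡ sumUpTo N f + sumUpTo N g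
  sumUpTo-+ zero    f g = refl
  sumUpTo-+ (suc N) f g =
    trans (cong (_+ (f (suc N) + g (suc N))) (sumUpTo-+ N f g))
          (interchange (sumUpTo N f) (sumUpTo N g) (f (suc N)) (g (suc N)))
    where
    interchange : ∀ a b c d → a + b + (c + d) ≡ a + c + (b + d)
    interchange = solve-∀

  sumUpTo-neg : ∀ N (f : ℕ → ℤ) → sumUpTo N (-_ ∘ f) ≡ - sumUpTo N f
  sumUpTo-neg zero    f = refl
  sumUpTo-neg (suc N) f =
    trans (cong (_+ - f (suc N)) (sumUpTo-neg N f)) (sym (ℤ.neg-distrib-+ (sumUpTo N f) (f (suc N))))

  sumUpTo-suc : ∀ N (f : ℕ → ℤ) → sumUpTo (suc N) f ≡ f 0 + sumUpTo N (f ∘ suc)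
  sumUpTo-suc zero    f = refl
  sumUpTo-suc (suc N) f =
    trans (cong (_+ f (2 ℕ.+ N)) (sumUpTo-suc N f)) (ℤ.+-assoc (f 0) (sumUpTo N (f ∘ suc)) (f (2 ℕ.+ N)))

  sumUpTo-zero : ∀ N (f : ℕ → ℤ) → (∀ i → f i ≡ + 0) → sumUpTo N f ≡ + 0
  sumUpTo-zero zero    f f≗0 = f≗0 0
  sumUpTo-zero (suc N) f f≗0 = cong₂ _+_ (sumUpTo-zero N f f≗0) (f≗0 (suc N))

  sumUpTo-extend : ∀ M N (f : ℕ → ℤ) → M ≤ N → (∀ i → M < i → f i ≡ + 0) →
                   sumUpTo N f ≡ sumUpTo M f
  sumUpTo-extend M N f M≤N vanish =
    subst (λ n → sumUpTo n f ≡ sumUpTo M f) (m∸n+n≡m M≤N) (pad (N ∸ M))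
    where
    pad : ∀ d → sumUpTo (d ℕ.+ M) f ≡ sumUpTo M f
    pad zero    = refl
    pad (suc d) = trans (cong₂ _+_ (pad d) (vanish (suc (d ℕ.+ M)) (s≤s (m≤n+m M d)))) (ℤ.+-identityʳ _)

  coeff-addL : ∀ p q k → coeff (addL p q) k ≡ coeff p k ℕ.+ coeff q k
  coeff-addL []      q       k       = refl
  coeff-addL (a ∷ p) []      k       = sym (ℕ.+-identityʳ _)
  coeff-addL (a ∷ p) (b ∷ q) zero    = refl
  coeff-addL (a ∷ p) (b ∷ q) (suc k) = coeff-addL p q k

  coeff-mul3 : ∀ p k → coeff (mul3 p) k ≡ coeff p k ℕ.+ (coeff (0 ∷ p) k ℕ.+ coeff (0 ∷ 0 ∷ p) k)
  coeff-mul3 p k = trans (coeff-addL p _ k) (cong (coeff p k ℕ.+_) (coeff-addL (0 ∷ p) (0 ∷ 0 ∷ p) k))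

  tri-suc : ∀ N w → tri (suc N) w ≡ tri N w + tri N (pred w) + tri N (pred (pred w))
  tri-suc N (+ 0)           = cong +_ (trans (coeff-mul3 t 0) (sym (ℕ.+-assoc (coeff t 0) 0 0)))
    where t = trinomPoly N
  tri-suc N (+ 1)           = cong +_ (trans (coeff-mul3 t 1) (sym (ℕ.+-assoc (coeff t 1) (coeff t 0) 0)))
    where t = trinomPoly N
  tri-suc N (+ suc (suc k)) = cong +_ (trans (coeff-mul3 t (2 ℕ.+ k))
                                             (sym (ℕ.+-assoc (coeff t (2 ℕ.+ k)) (coeff t (suc k)) (coeff t k))))
    where t = trinomPoly N
  tri-suc N -[1+ _ ]        = refl

  pascal : ∀ m j → (suc m ∸ j) C suc j ≡ (m ∸ j) C suc j ℕ.+ (m ∸ j) C j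
  pascal m j with ≤-<-connex j m
  ... | inj₁ j≤m = begin
    (suc m ∸ j) C suc j              ≡⟨ cong (_C suc j) (+-∸-assoc 1 j≤m) ⟩
    suc (m ∸ j) C suc j              ≡⟨ sym (nCk+nC[k+1]≡[n+1]C[k+1] (m ∸ j) j) ⟩
    (m ∸ j) C j ℕ.+ (m ∸ j) C suc j  ≡⟨ +-comm ((m ∸ j) C j) _ ⟩
    (m ∸ j) C suc j ℕ.+ (m ∸ j) C j  ∎
    where open ≡-Reasoning
  pascal m (suc j) | inj₂ (s≤s m≤j) rewrite m≤n⇒m∸n≡0 m≤j | m≤n⇒m∸n≡0 (m≤n⇒m≤1+n m≤j) = refl

  binomial-vanish : ∀ m i → m < i ℕ.* 2 → (m ∸ i) C i ≡ 0
  binomial-vanish m zero    ()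
  binomial-vanish m (suc i) m<2i = k>n⇒nCk≡0 (ℕ.m<n+o⇒m∸n<o m (suc i) (subst (m <_) double m<2i))
    where
    double : suc i ℕ.* 2 ≡ suc i ℕ.+ suc i
    double = trans (*-comm (suc i) 2) (cong (suc i ℕ.+_) (ℕ.+-identityʳ (suc i)))

  half<⇒<double : ∀ m i → m / 2 < i → m < i ℕ.* 2
  half<⇒<double m i m/2<i =
    ≰⇒> λ 2i≤m → <⇒≱ m/2<i (subst (_≤ m / 2) (m*n/n≡m i 2) (/-monoˡ-≤ 2 2i≤m))

  minus-suc : ∀ w t → w - + suc t ≡ pred w - + t
  minus-suc w t = shift w (+ t)
    where
    shift : ∀ w d → w - (+ 1 + d) ≡ ℤ.-1ℤ + w - d
    shift = solve-∀

  -- chebyshev m is U_m = Σ_i (−1)^i C(m−i, i) x^{2i} (1 + x + x²)^{m−2i}; terms with 2i > m vanish.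
  chebyshevTerm : ℕ → ℕ → Series
  chebyshevTerm m i w = sgn i * binZ (m ∸ i) i * tri (m ∸ i ℕ.* 2) (w - + (i ℕ.* 2))

  chebyshev : ℕ → Series
  chebyshev m w = sumUpTo m (λ i → chebyshevTerm m i w)

  chebyshevTerm-vanish : ∀ m i w → m < i ℕ.* 2 → chebyshevTerm m i w ≡ + 0
  chebyshevTerm-vanish m i w m<2i rewrite binomial-vanish m i m<2i =
    cong (_* tri (m ∸ i ℕ.* 2) (w - + (i ℕ.* 2))) (ℤ.*-zeroʳ (sgn i))

  chebyshevTerm-negative : ∀ m i n → chebyshevTerm m i -[1+ n ] ≡ + 0
  chebyshevTerm-negative m zero    n = ℤ.*-zeroʳ (sgn 0 * binZ m 0)
  chebyshevTerm-negative m (suc i) n = ℤ.*-zeroʳ (sgn (suc i) * binZ (m ∸ suc i) (suc i))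

  chebyshev-negative : ∀ m n → chebyshev m -[1+ n ] ≡ + 0
  chebyshev-negative m n = sumUpTo-zero m _ (λ i → chebyshevTerm-negative m i n)

  chebyshev-extend : ∀ m N w → m ≤ N → sumUpTo N (λ i → chebyshevTerm m i w) ≡ chebyshev m w
  chebyshev-extend m N w m≤N = sumUpTo-extend m N _ m≤N
    (λ i m<i → chebyshevTerm-vanish m i w (ℕ.<-≤-trans m<i (ℕ.m≤m*n i 2)))

  chebyshev-half : ∀ m w → sumUpTo (m / 2) (λ i → chebyshevTerm m i w) ≡ chebyshev m w
  chebyshev-half m w = sym (sumUpTo-extend (m / 2) m _ (m/n≤m m 2)
    (λ i m/2<i → chebyshevTerm-vanish m i w (half<⇒<double m i m/2<i)))

  -- The i-th term of (1 + x + x²) U_{m+1}, with the factor 1 + x + x² absorbed into the power.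
  raisedTerm : ℕ → ℕ → Series
  raisedTerm m i w = sgn i * binZ (suc m ∸ i) i * tri (2 ℕ.+ m ∸ i ℕ.* 2) (w - + (i ℕ.* 2))

  raisedTerm-trinomial : ∀ m i w → raisedTerm m i w ≡
    chebyshevTerm (suc m) i w + chebyshevTerm (suc m) i (pred w) + chebyshevTerm (suc m) i (pred (pred w))
  raisedTerm-trinomial m i w with ≤-<-connex (i ℕ.* 2) (suc m)
  ... | inj₁ 2i≤1+m = begin
    c * tri (2 ℕ.+ m ∸ i ℕ.* 2) (w - x)
      ≡⟨ cong (λ N → c * tri N (w - x)) (+-∸-assoc 1 2i≤1+m) ⟩
    c * tri (suc N) (w - x)
      ≡⟨ cong (c *_) (tri-suc N (w - x)) ⟩
    c * (tri N (w - x) + tri N (pred (w - x)) + tri N (pred (pred (w - x))))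
      ≡⟨ distrib c (tri N (w - x)) (tri N (pred (w - x))) (tri N (pred (pred (w - x)))) ⟩
    c * tri N (w - x) + c * tri N (pred (w - x)) + c * tri N (pred (pred (w - x)))
      ≡⟨ cong₂ (λ u u′ → c * tri N (w - x) + c * tri N u + c * tri N u′)
               (pred-minus w) (trans (cong pred (pred-minus w)) (pred-minus (pred w))) ⟩
    c * tri N (w - x) + c * tri N (pred w - x) + c * tri N (pred (pred w) - x) ∎
    where
    open ≡-Reasoning
    c = sgn i * binZ (suc m ∸ i) i
    N = suc m ∸ i ℕ.* 2
    x = + (i ℕ.* 2)
    pred-minus : ∀ u → pred (u - x) ≡ pred u - x
    pred-minus u = sym (ℤ.pred-+ u (- x))
    distrib : ∀ c a b d → c * (a + b + d) ≡ c * a + c * b + c * d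
    distrib = solve-∀
  ... | inj₂ 1+m<2i = begin
    raisedTerm m i w  ≡⟨ cong (λ b → sgn i * + b * t) (binomial-vanish (suc m) i 1+m<2i) ⟩
    sgn i * + 0 * t   ≡⟨ cong (_* t) (ℤ.*-zeroʳ (sgn i)) ⟩
    + 0               ≡⟨ sym (cong₂ _+_ (cong₂ _+_ (vanish w) (vanish (pred w))) (vanish (pred (pred w)))) ⟩
    _                 ∎
    where
    open ≡-Reasoning
    t = tri (2 ℕ.+ m ∸ i ℕ.* 2) (w - + (i ℕ.* 2))
    vanish : ∀ u → chebyshevTerm (suc m) i u ≡ + 0
    vanish u = chebyshevTerm-vanish (suc m) i u 1+m<2i

  chebyshevTerm-pascal : ∀ m j w →
    chebyshevTerm (2 ℕ.+ m) (suc j) w ≡ raisedTerm m (suc j) w - chebyshevTerm m j (pred (pred w))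
  chebyshevTerm-pascal m j w = begin
    sgn (suc j) * binZ (suc m ∸ j) (suc j) * t
      ≡⟨ cong₂ (λ s c → s * c * t) (ℤ.-1*i≡-i (sgn j)) (cong +_ (pascal m j)) ⟩
    - sgn j * (+ a + + b) * t
      ≡⟨ distrib (sgn j) (+ a) (+ b) t ⟩
    - sgn j * + a * t - sgn j * + b * t
      ≡⟨ cong₂ (λ s u → s * + a * t - sgn j * + b * tri (m ∸ j ℕ.* 2) u) (sym (ℤ.-1*i≡-i (sgn j)))
               (trans (minus-suc w (suc (j ℕ.* 2))) (minus-suc (pred w) (j ℕ.* 2))) ⟩
    raisedTerm m (suc j) w - chebyshevTerm m j (pred (pred w)) ∎
    where
    open ≡-Reasoning
    a = (m ∸ j) C suc j
    b = (m ∸ j) C j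
    t = tri (m ∸ j ℕ.* 2) (w - + (2 ℕ.+ j ℕ.* 2))
    distrib : ∀ s a b t → - s * (a + b) * t ≡ - s * a * t - s * b * t
    distrib = solve-∀

  raisedTerm-sum : ∀ m w → sumUpTo (2 ℕ.+ m) (λ i → raisedTerm m i w) ≡
    chebyshev (suc m) w + chebyshev (suc m) (pred w) + chebyshev (suc m) (pred (pred w))
  raisedTerm-sum m w = begin
    Σ (λ i → raisedTerm m i w)
      ≡⟨ sumUpTo-cong (2 ℕ.+ m) (λ i → raisedTerm-trinomial m i w) ⟩
    Σ (λ i → term i w + term i (pred w) + term i (pred (pred w)))
      ≡⟨ sumUpTo-+ (2 ℕ.+ m) _ _ ⟩
    Σ (λ i → term i w + term i (pred w)) + Σ (λ i → term i (pred (pred w)))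
      ≡⟨ cong (_+ Σ (λ i → term i (pred (pred w)))) (sumUpTo-+ (2 ℕ.+ m) _ _) ⟩
    Σ (λ i → term i w) + Σ (λ i → term i (pred w)) + Σ (λ i → term i (pred (pred w)))
      ≡⟨ cong₂ _+_ (cong₂ _+_ (extend w) (extend (pred w))) (extend (pred (pred w))) ⟩
    chebyshev (suc m) w + chebyshev (suc m) (pred w) + chebyshev (suc m) (pred (pred w)) ∎
    where
    open ≡-Reasoning
    Σ : (ℕ → ℤ) → ℤ
    Σ = sumUpTo (2 ℕ.+ m)
    term = chebyshevTerm (suc m)
    extend : ∀ u → Σ (λ i → term i u) ≡ chebyshev (suc m) u
    extend u = chebyshev-extend (suc m) (2 ℕ.+ m) u (n≤1+n (suc m))

  -- Pascal's rule splits C(m+2−i, i) into the terms of (1 + x + x²) U_{m+1} and of −x² U_m.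
  chebyshev-recurrence : ∀ m → Recurrence₁ chebyshev m
  chebyshev-recurrence m = recurrence step
    where
    step : ∀ w → chebyshev (2 ℕ.+ m) w ≡ chebyshev (suc m) w + chebyshev (suc m) (pred w)
                                         + chebyshev (suc m) (pred (pred w)) - chebyshev m (pred (pred w))
    step w = begin
      chebyshev (2 ℕ.+ m) w
        ≡⟨ sumUpTo-suc (suc m) _ ⟩
      raisedTerm m 0 w + Σ (λ j → chebyshevTerm (2 ℕ.+ m) (suc j) w)
        ≡⟨ cong (λ t → raisedTerm m 0 w + t) (sumUpTo-cong (suc m) (λ j → chebyshevTerm-pascal m j w)) ⟩
      raisedTerm m 0 w + Σ (λ j → raisedTerm m (suc j) w - lower j)
        ≡⟨ cong (λ t → raisedTerm m 0 w + t) (sumUpTo-+ (suc m) _ _) ⟩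
      raisedTerm m 0 w + (Σ (λ j → raisedTerm m (suc j) w) + Σ (-_ ∘ lower))
        ≡⟨ sym (ℤ.+-assoc (raisedTerm m 0 w) (Σ (λ j → raisedTerm m (suc j) w)) _) ⟩
      raisedTerm m 0 w + Σ (λ j → raisedTerm m (suc j) w) + Σ (-_ ∘ lower)
        ≡⟨ cong₂ _+_ (sym (sumUpTo-suc (suc m) _))
                     (trans (sumUpTo-neg (suc m) lower)
                            (cong -_ (chebyshev-extend m (suc m) (pred (pred w)) (n≤1+n m)))) ⟩
      sumUpTo (2 ℕ.+ m) (λ i → raisedTerm m i w) - chebyshev m (pred (pred w))
        ≡⟨ cong (_- chebyshev m (pred (pred w))) (raisedTerm-sum m w) ⟩
      chebyshev (suc m) w + chebyshev (suc m) (pred w) + chebyshev (suc m) (pred (pred w))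
        - chebyshev m (pred (pred w)) ∎
      where
      open ≡-Reasoning
      Σ : (ℕ → ℤ) → ℤ
      Σ = sumUpTo (suc m)
      lower : ℕ → ℤ
      lower j = chebyshevTerm m j (pred (pred w))

  [j+n∸i]∸j≡n∸i : ∀ j n i → j ℕ.+ n ∸ i ∸ j ≡ n ∸ i
  [j+n∸i]∸j≡n∸i j n i = begin
    j ℕ.+ n ∸ i ∸ j          ≡⟨ ℕ.∸-+-assoc (j ℕ.+ n) i j ⟩
    j ℕ.+ n ∸ (i ℕ.+ j)      ≡⟨ cong (j ℕ.+ n ∸_) (+-comm i j) ⟩
    j ℕ.+ n ∸ (j ℕ.+ i)      ≡⟨ ℕ.[m+n]∸[m+o]≡n∸o j n i ⟩
    n ∸ i                    ∎
    where open ≡-Reasoning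

  -- The sums in evenFormula and oddFormula run over m − j for j = 0, 1, 2; writing their top index
  -- as j + n ∸ … ∸ j matches them definitionally.
  formulaTerm : ℕ → ℕ → ℕ → ℤ → ℤ
  formulaTerm j n i u = sgn i * binZ (j ℕ.+ n ∸ i ∸ j) i * tri (j ℕ.+ n ∸ 2 ℕ.* i ∸ j) u

  formulaTerm≡chebyshevTerm : ∀ j n i w → formulaTerm j n i (w - + (2 ℕ.* i)) ≡ chebyshevTerm n i w
  formulaTerm≡chebyshevTerm j n i w rewrite [j+n∸i]∸j≡n∸i j n i | [j+n∸i]∸j≡n∸i j n (2 ℕ.* i)
                                          | *-comm 2 i = refl

  formulaSum≡chebyshev : ∀ j n w →
    sumUpTo (n / 2) (λ i → formulaTerm j n i (w - + (2 ℕ.* i))) ≡ chebyshev n w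
  formulaSum≡chebyshev j n w =
    trans (sumUpTo-cong (n / 2) (λ i → formulaTerm≡chebyshevTerm j n i w)) (chebyshev-half n w)

  formulaPair : ℕ → ℕ → ℕ → ℤ → ℤ → ℤ
  formulaPair j n i u u′ =
    sgn i * binZ (j ℕ.+ n ∸ i ∸ j) i * (tri (j ℕ.+ n ∸ 2 ℕ.* i ∸ j) u + tri (j ℕ.+ n ∸ 2 ℕ.* i ∸ j) u′)

  formulaPairSum≡chebyshev : ∀ j n w →
    sumUpTo (n / 2) (λ i → formulaPair j n i (w - + (2 ℕ.* i)) (w - + suc (2 ℕ.* i)))
      ≡ chebyshev n w + chebyshev n (pred w)
  formulaPairSum≡chebyshev j n w =
    trans (sumUpTo-cong (n / 2) pair)
          (trans (sumUpTo-+ (n / 2) _ _)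
                 (cong₂ _+_ (formulaSum≡chebyshev j n w) (formulaSum≡chebyshev j n (pred w))))
    where
    pair : ∀ i → formulaPair j n i (w - + (2 ℕ.* i)) (w - + suc (2 ℕ.* i))
               ≡ formulaTerm j n i (w - + (2 ℕ.* i)) + formulaTerm j n i (pred w - + (2 ℕ.* i))
    pair i = trans (ℤ.*-distribˡ-+ (sgn i * binZ (j ℕ.+ n ∸ i ∸ j) i) _ _)
                   (cong (λ u → formulaTerm j n i (w - + (2 ℕ.* i)) + formulaTerm j n i u)
                         (minus-suc w (2 ℕ.* i)))

  evenSeries oddSeries : ℕ → Series
  evenSeries m (+ k)    = evenFormula m k
  evenSeries m -[1+ _ ] = + 0
  oddSeries m (+ k)     = oddFormula m k
  oddSeries m -[1+ _ ]  = + 0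

  evenSeries-chebyshev : ∀ m →
    evenSeries (2 ℕ.+ m) ≗ λ w → chebyshev (2 ℕ.+ m) w + (- chebyshev (suc m) w + chebyshev m w)
  evenSeries-chebyshev m (+ k) =
    cong₂ _+_ (trans (ℤ.+-identityˡ _) (formulaSum≡chebyshev 0 (2 ℕ.+ m) (+ k)))
              (cong₂ _+_ (cong -_ (formulaSum≡chebyshev 1 (suc m) (+ k))) (formulaSum≡chebyshev 2 m (+ k)))
  evenSeries-chebyshev m -[1+ n ]
    rewrite chebyshev-negative (2 ℕ.+ m) n | chebyshev-negative (suc m) n | chebyshev-negative m n = refl

  oddSeries-chebyshev : ∀ m → oddSeries (suc m) ≗ λ w →
    chebyshev (suc m) w + chebyshev (suc m) (pred w) - (chebyshev m (pred w) + chebyshev m (pred (pred w)))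
  oddSeries-chebyshev m (+ k) =
    cong₂ _-_ (formulaPairSum≡chebyshev 0 (suc m) (+ k))
              (trans (sumUpTo-cong (m / 2) shift) (formulaPairSum≡chebyshev 1 m (pred (+ k))))
    where
    shift : ∀ i → formulaPair 1 m i (k ⊖ suc (2 ℕ.* i)) (k ⊖ suc (suc (2 ℕ.* i)))
                ≡ formulaPair 1 m i (pred (+ k) - + (2 ℕ.* i)) (pred (+ k) - + suc (2 ℕ.* i))
    shift i = cong₂ (formulaPair 1 m i) (minus-suc (+ k) (2 ℕ.* i)) (minus-suc (+ k) (suc (2 ℕ.* i)))
  oddSeries-chebyshev m -[1+ n ]
    rewrite chebyshev-negative (suc m) n | chebyshev-negative (suc m) (suc n)
          | chebyshev-negative m (suc n) | chebyshev-negative m (suc (suc n)) = refl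

  evenSeries-recurrence : ∀ m → Recurrence₁ evenSeries (2 ℕ.+ m)
  evenSeries-recurrence m =
    Recurrence-≗ (sym ∘ evenSeries-chebyshev m) (sym ∘ evenSeries-chebyshev (suc m))
                 (sym ∘ evenSeries-chebyshev (2 ℕ.+ m))
      (Recurrence-+ (chebyshev-recurrence (2 ℕ.+ m))
                    (Recurrence-+ (Recurrence-neg (chebyshev-recurrence (suc m))) (chebyshev-recurrence m)))

  oddSeries-recurrence : ∀ m → Recurrence₁ oddSeries (suc m)
  oddSeries-recurrence m =
    Recurrence-≗ (sym ∘ oddSeries-chebyshev m) (sym ∘ oddSeries-chebyshev (suc m))
                 (sym ∘ oddSeries-chebyshev (2 ℕ.+ m))
      (Recurrence-+ (Recurrence-+ U₁ (Recurrence-pred U₁))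
                    (Recurrence-neg (Recurrence-+ (Recurrence-pred U₀) (Recurrence-pred (Recurrence-pred U₀)))))
    where
    U₀ : Recurrence₁ chebyshev m
    U₀ = chebyshev-recurrence m
    U₁ : Recurrence₁ chebyshev (suc m)
    U₁ = chebyshev-recurrence (suc m)

open Chebyshev using (evenSeries; oddSeries; evenSeries-recurrence; oddSeries-recurrence)

open import Data.Nat using (_*_)

Recurrence-unique : (F G : ℕ → Series) → (∀ j → Recurrence₁ F j) → (∀ j → Recurrence₁ G j) →
                    F 0 ≗ G 0 → F 1 ≗ G 1 → ∀ j → F j ≗ G j
Recurrence-unique F G recF recG F₀≗G₀ F₁≗G₁ j = proj₁ (consecutive j)
  where
  consecutive : ∀ j → F j ≗ G j × F (suc j) ≗ G (suc j)
  consecutive zero    = F₀≗G₀ , F₁≗G₁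
  consecutive (suc j) with consecutive j
  ... | Fⱼ≗Gⱼ , Fⱼ₊₁≗Gⱼ₊₁ = Fⱼ₊₁≗Gⱼ₊₁ , λ w → begin
    F (2 ℕ.+ j) w
      ≡⟨ at (recF j) w ⟩
    F (suc j) w + F (suc j) (pred w) + F (suc j) (pred (pred w)) - F j (pred (pred w))
      ≡⟨ cong₂ _-_ (cong₂ _+_ (cong₂ _+_ (Fⱼ₊₁≗Gⱼ₊₁ w) (Fⱼ₊₁≗Gⱼ₊₁ (pred w)))
                              (Fⱼ₊₁≗Gⱼ₊₁ (pred (pred w))))
                   (Fⱼ≗Gⱼ (pred (pred w))) ⟩
    G (suc j) w + G (suc j) (pred w) + G (suc j) (pred (pred w)) - G j (pred (pred w))
      ≡⟨ sym (at (recG j) w) ⟩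
    G (2 ℕ.+ j) w ∎
    where open ≡-Reasoning

-- Applied with table = refl and tail = λ _ → refl: beyond the degree both sides evaluate to 0
-- even at a symbolic exponent d + k, so the initial cases are settled by evaluation.
agree-by-table : ∀ (f g : Series) d → (∀ n → f -[1+ n ] ≡ g -[1+ n ]) →
  tabulate {n = d} (λ i → f (+ toℕ i)) ≡ tabulate (λ i → g (+ toℕ i)) →
  (∀ k → f (+ (d ℕ.+ k)) ≡ g (+ (d ℕ.+ k))) → f ≗ g
agree-by-table f g d negative table tail -[1+ n ] = negative n
agree-by-table f g d negative table tail (+ k) with k <? d
... | yes k<d = begin
  f (+ k)                                  ≡⟨ cong (λ n → f (+ n)) (sym (toℕ-fromℕ< k<d)) ⟩
  f (+ toℕ i)                              ≡⟨ sym (lookup∘tabulate _ i) ⟩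
  lookup (tabulate (λ i → f (+ toℕ i))) i  ≡⟨ cong (λ v → lookup v i) table ⟩
  lookup (tabulate (λ i → g (+ toℕ i))) i  ≡⟨ lookup∘tabulate _ i ⟩
  g (+ toℕ i)                              ≡⟨ cong (λ n → g (+ n)) (toℕ-fromℕ< k<d) ⟩
  g (+ k)                                  ∎
  where
  open ≡-Reasoning
  i = fromℕ< k<d
... | no k≮d = subst (λ n → f (+ n) ≡ g (+ n)) (m+[n∸m]≡n (≮⇒≥ k≮d)) (tail (k ℕ.∸ d))

-- The fence is irregular up to x₅, so its recurrence only links n, n + 2, n + 4 from n = 5 on.
fenceSeries-even : ∀ m → fenceSeries (m ℕ.* 2) ≗ evenSeries m
fenceSeries-even 0 = agree-by-table _ _ 1 (λ _ → refl) refl (λ _ → refl)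
fenceSeries-even 1 = agree-by-table _ _ 3 (λ _ → refl) refl (λ _ → refl)
fenceSeries-even 2 = agree-by-table _ _ 5 (λ _ → refl) refl (λ _ → refl)
fenceSeries-even (suc (suc (suc j))) =
  Recurrence-unique (λ j → fenceSeries ((3 ℕ.+ j) ℕ.* 2)) (λ j → evenSeries (3 ℕ.+ j))
    (λ j → fenceSeries-recurrence (suc (j ℕ.* 2))) (λ j → evenSeries-recurrence (suc j))
    (agree-by-table _ _ 7 (λ _ → refl) refl (λ _ → refl))
    (agree-by-table _ _ 9 (λ _ → refl) refl (λ _ → refl)) j

fenceSeries-odd : ∀ m → fenceSeries (suc (m ℕ.* 2)) ≗ oddSeries m
fenceSeries-odd 0 = agree-by-table _ _ 2 (λ _ → refl) refl (λ _ → refl)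
fenceSeries-odd 1 = agree-by-table _ _ 4 (λ _ → refl) refl (λ _ → refl)
fenceSeries-odd (suc (suc j)) =
  Recurrence-unique (λ j → fenceSeries (suc ((2 ℕ.+ j) ℕ.* 2))) (λ j → oddSeries (2 ℕ.+ j))
    (λ j → fenceSeries-recurrence (j ℕ.* 2)) (λ j → oddSeries-recurrence (suc j))
    (agree-by-table _ _ 6 (λ _ → refl) refl (λ _ → refl))
    (agree-by-table _ _ 8 (λ _ → refl) refl (λ _ → refl)) j

theorem2 : (m k : ℕ) →
    (+ r (2 * m) k ≡ evenFormula m k) × (+ r (suc (2 * m)) k ≡ oddFormula m k)
theorem2 m k rewrite *-comm 2 m =
  trans (r≡fenceSeries (m ℕ.* 2) k) (fenceSeries-even m (+ k)) ,
  trans (r≡fenceSeries (suc (m ℕ.* 2)) k) (fenceSeries-odd m (+ k))
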